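{- Let $K,N\ge 1$ be integers and let $u(i,j)\in\mathbb{N}=\{0,1,2,\dots\}$ for $i\ge 1$, $1\le j\le K$. Queue tandem: define $D(n,j)$ for $n\ge 0$, $0\le j\le K$ by $D(0,j)=0$, $D(n,0)=0$ and $D(n,j)=\max(D(n-1,j),D(n,j-1))+u(n,j)$ for $n,j\ge1$, and set $D=D(N,K)$ (the instant of departure of customer $N$ from queue $K$ in a tandem of $K$ FIFO single-server queues, initially empty except for infinitely many customers $1,2,\dots$ waiting at queue $1$ at time $0$, where $u(i,j)$ is the service time of customer $i$ at queue $j$). Store tandem: for store $1$ set $R_1(n)=u(n,K)$ for $n\ge1$, $R_1(0)=0$. For stores $k=2,\dots,K$ set $L_k(0)=0$, $R_k(0)=0$ and for $n\ge 1$: supply $S_k(n)=R_{k-1}(n-1)$, departure $R_k(n)=\min\big(L_k(n-1)+S_k(n),\,u(n,K+1-k)\big)$, stock $L_k(n)=L_k(n-1)+S_k(n)-R_k(n)$. Set $R=\sum_{n=1}^N R_K(n)$ (cumulative departures from store $K$ over time slots $1$ to $N$; here $u(i,K+1-k)$ is the request at slot $i$ in store $k$). Let $w(U)$ be the word $w_1w_2\cdots w_N$ over the alphabet $\{1,\dots,K\}$ where $w_i=1^{u(i,1)}2^{u(i,2)}\cdots K^{u(i,K)}$ (letter $j$ repeated $u(i,j)$ times), let $P$ be the tableau obtained by RSK row-insertion of the letters of $w(U)$ one by one from left to right into the empty tableau, and let $(\lambda_1,\dots,\lambda_K)$ be its shape. Let $\Pi$ be the set of lattice paths from $(1,1)$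 to $(N,K)$ with steps $(1,0)$ or $(0,1)$, and let $\widetilde\Pi$ be the set of lattice paths starting at a point of $\{(1+i,K-i):0\le i\le K-1\}$, ending at a point of $\{(N-j,1+j):0\le j\le N-1\}$, all of whose steps are of the form $(1+i,-i)$ with $i\ge0$. Then $$\lambda_1=\max_{\pi\in\Pi}\sum_{(i,j)\in\pi}u(i,j)=D,\qquad \lambda_K=\min_{\pi\in\widetilde\Pi}\sum_{(i,j)\in\pi}u(i,j)=R.$$
   Context: RSK row insertion $T\leftarrow i$ of a letter $i$ into a semi-standard Young tableau $T$ (rows weakly increasing left to right, columns strictly increasing top to bottom): if $i$ is at least every entry of the first row, append a box labelled $i$ at the end of the first row; otherwise replace the leftmost entry of the first row strictly larger than $i$ by $i$ and insert the bumped entry into the second row by the same rule, and so on (an empty row accepts any letter). The shape is the sequence of row lengths $\lambda_1\ge\lambda_2\ge\cdots\ge\lambda_K\ge0$ (padded with zeros). When $N<K$, $\widetilde\Pi$ is empty and the minimum over it is taken to be $0$. -}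

module Defs where

open import Data.Nat using (ℕ; zero; suc; _+_; _∸_; _⊔_; _⊓_; _≤_; _<_; _≤ᵇ_)
open import Data.Bool using (if_then_else_)
open import Data.Product using (_×_; _,_; proj₁; proj₂; ∃)
open import Data.Sum using (_⊎_)
open import Data.Maybe using (Maybe; just; nothing)
open import Data.List using (List; []; _∷_; length; map; replicate; concat; head; last)
open import Data.Nat.ListAction using (sum)
open import Relation.Binary.PropositionalEquality using (_≡_)
open import Relation.Nullary using (¬_)

-- The array u(i,j) is given as a function ℕ → ℕ → ℕ; only the values with
-- 1 ≤ i ≤ N and 1 ≤ j ≤ K are ever used.
Array : Set
Array = ℕ → ℕ → ℕ

from1 : ℕ → List ℕ
from1 zero    = []
from1 (suc n) = concat (from1 n ∷ (suc n ∷ []) ∷ [])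

Dq : Array → ℕ → ℕ → ℕ
Dq u zero    j       = 0
Dq u (suc n) zero    = 0
Dq u (suc n) (suc j) = (Dq u n (suc j) ⊔ Dq u (suc n) j) + u (suc n) (suc j)

-- Store tandem.  store u K m n = (L_k(n) , R_k(n)) for store k = m + 1.
-- (For store 1 only R_1 is meaningful; its L-component is set to 0.)

store : Array → ℕ → ℕ → ℕ → ℕ × ℕ
store u K zero    zero    = 0 , 0
store u K zero    (suc n) = 0 , u (suc n) K
store u K (suc m) zero    = 0 , 0
store u K (suc m) (suc n) =
  let S  = proj₂ (store u K m n)
      Lp = proj₁ (store u K (suc m) n)
      r  = (Lp + S) ⊓ u (suc n) (K ∸ suc m) -- request u(n, K+1-k), k = m+2
  in (Lp + S ∸ r) , r

Rstore : Array → ℕ → ℕ → ℕ → ℕ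
Rstore u K k n = proj₂ (store u K (k ∸ 1) n)

Rtot : Array → ℕ → ℕ → ℕ
Rtot u K N = sum (map (Rstore u K K) (from1 N))

word : Array → ℕ → ℕ → List ℕ
word u K N = concat (map (λ i → concat (map (λ j → replicate (u i j) j) (from1 K))) (from1 N))

rowInsert : ℕ → List ℕ → List ℕ × Maybe ℕ
rowInsert x []       = x ∷ [] , nothing
rowInsert x (y ∷ ys) =
  if x <ᵇ' y then (x ∷ ys , just y)
  else (let r = rowInsert x ys in (y ∷ proj₁ r) , proj₂ r)
  where
    _<ᵇ'_ : ℕ → ℕ → _
    a <ᵇ' b = suc a ≤ᵇ b

Tableau : Set
Tableau = List (List ℕ)

insert : ℕ → Tableau → Tableau
insert x []       = (x ∷ []) ∷ []
insert x (r ∷ rs) with rowInsert x r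
... | r' , nothing = r' ∷ rs
... | r' , just y  = r' ∷ insert y rs

insertAll : List ℕ → Tableau → Tableau
insertAll []       T = T
insertAll (x ∷ xs) T = insertAll xs (insert x T)

rsk : List ℕ → Tableau
rsk w = insertAll w []

-- λ_k = length of row k (1-based), padded with zeros
shapePart : Tableau → ℕ → ℕ
shapePart []       _             = 0
shapePart (r ∷ rs) zero          = 0
shapePart (r ∷ rs) (suc zero)    = length r
shapePart (r ∷ rs) (suc (suc k)) = shapePart rs (suc k)

Point : Set
Point = ℕ × ℕ

data Chain (Step : Point → Point → Set) : List Point → Set where
  []  : Chain Step []
  [-] : ∀ {p} → Chain Step (p ∷ [])
  _∷_ : ∀ {p q ps} → Step p q → Chain Step (q ∷ ps) → Chain Step (p ∷ q ∷ ps)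

UpRight : Point → Point → Set
UpRight (a , b) (c , d) = (c ≡ suc a × d ≡ b) ⊎ (c ≡ a × d ≡ suc b)

Diag : Point → Point → Set
Diag (a , b) (c , d) = ∃ λ t → c ≡ a + suc t × b ≡ d + t

InΠ : ℕ → ℕ → List Point → Set
InΠ N K π = head π ≡ just (1 , 1) × last π ≡ just (N , K) × Chain UpRight π

InΠ~ : ℕ → ℕ → List Point → Set
InΠ~ N K π =
  (∃ λ i → i < K × head π ≡ just (suc i , K ∸ i)) ×
  (∃ λ j → j < N × last π ≡ just (N ∸ j , suc j)) ×
  Chain Diag π

weight : Array → List Point → ℕ
weight u π = sum (map (λ p → u (proj₁ p) (proj₂ p)) π)

IsMax : (List Point → Set) → (List Point → ℕ) → ℕ → Set
IsMax P f v = (∃ λ π → P π × f π ≡ v) × (∀ π → P π → f π ≤ v)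

-- v = min_{P π} f π, with the convention min over the empty set = 0
IsMin0 : (List Point → Set) → (List Point → ℕ) → ℕ → Set
IsMin0 P f v =
  ((∃ λ π → P π × f π ≡ v) × (∀ π → P π → v ≤ f π))
  ⊎ ((¬ ∃ λ π → P π) × v ≡ 0)

-- Inserting one block w_i of w(U) into a row r, the number of entries < j+1 of the
-- new row obeys the max-plus recursion of a tandem of queues, with the entries < j
-- as arrivals and the j's of w_i as service demand.  Hence the first row after n
-- blocks holds exactly D(n,j) letters ≤ j, which gives λ₁ = D, and the last-passage
-- recursion for D gives the maximum over Π.
--
-- Applying the same recursion to two consecutive letters and using conservation of
-- letters under bumping yields an exchange identity
--   #(j+1 bumped) ⊓ #(j in new row) = #(j+1 in old row) ⊓ #(j in w_i).
-- It makes the minimum, over staircase selections of rows, of the letter counts on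
-- them evolve under each block by the min-plus recursion of the store tandem.  The
-- smallest such selection counts the K's of row K, i.e. λ_K, so λ_K = R, and the
-- same min-plus recursion characterises the minimum over Π̃.

module Submission where

open import Defs
open import Data.Bool using (Bool; true; false; if_then_else_)
import Data.Bool as Bool
open import Data.Nat using (ℕ; zero; suc; s≤s⁻¹; _+_; _∸_; _⊔_; _⊓_; _≤_; _<_; _<ᵇ_; _≡ᵇ_; z≤n; s≤s)
open import Data.Nat.Properties
open import Data.Sum using (inj₁; inj₂)
open import Data.Product using (_×_; _,_; proj₁; proj₂; ∃)
open import Data.Product.Properties using (,-injective)
open import Data.Nat.ListAction using (sum)
open import Data.Nat.ListAction.Properties using (sum-++)
open import Data.Maybe using (Maybe; just; nothing)
open import Data.Maybe.Properties using (just-injective)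
open import Data.List using (List; []; _∷_; _++_; _∷ʳ_; length; map; concat; replicate; fromMaybe; head; last; initLast; _∷ʳ′_)
open import Data.List.Properties using (map-++; concat-++; ++-identityʳ)
import Data.List.Relation.Unary.AllPairs.Properties as AllPairs
open import Data.List.Relation.Unary.All as All using (All; []; _∷_)
open import Data.List.Relation.Unary.All.Properties using (++⁺; replicate⁺)
open import Data.List.Relation.Unary.AllPairs using (AllPairs; []; _∷_)
open import Relation.Binary.PropositionalEquality
open import Relation.Binary.Definitions using (tri<; tri≈; tri>)
open import Relation.Nullary using (yes; no; contradiction)
open import Algebra.Properties.CommutativeSemigroup +-commutativeSemigroup using (interchange; xy∙z≈y∙xz; xy∙z≈xz∙y; xy∙z≈x∙zy; x∙yz≈xz∙y)
open import Data.Nat.Tactic.RingSolver using (solve-∀)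
open import Function using (_∘′_)
open import Data.Unit using (⊤; tt)

<⇒<ᵇ≡true : ∀ {x j} → x < j → (x <ᵇ j) ≡ true
<⇒<ᵇ≡true {zero}  (s≤s _)         = refl
<⇒<ᵇ≡true {suc x} (s≤s x<j@(s≤s _)) = <⇒<ᵇ≡true x<j

≥⇒<ᵇ≡false : ∀ {x j} → j ≤ x → (x <ᵇ j) ≡ false
≥⇒<ᵇ≡false z≤n     = refl
≥⇒<ᵇ≡false (s≤s p) = ≥⇒<ᵇ≡false p

<ᵇ≡true⇒< : ∀ x j → (x <ᵇ j) ≡ true → x < j
<ᵇ≡true⇒< x j e = <ᵇ⇒< x j (subst Bool.T (sym e) _)

<ᵇ≡false⇒≥ : ∀ x j → (x <ᵇ j) ≡ false → j ≤ x
<ᵇ≡false⇒≥ x j e with j ≤? x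
... | yes j≤x = j≤x
... | no  j≰x with () ← trans (sym e) (<⇒<ᵇ≡true (≰⇒> j≰x))

≡ᵇ-refl : ∀ x → (x ≡ᵇ x) ≡ true
≡ᵇ-refl zero    = refl
≡ᵇ-refl (suc x) = ≡ᵇ-refl x

≢⇒≡ᵇ≡false : ∀ {x j} → x ≢ j → (x ≡ᵇ j) ≡ false
≢⇒≡ᵇ≡false {zero}  {zero}  x≢j with () ← x≢j refl
≢⇒≡ᵇ≡false {zero}  {suc j} _   = refl
≢⇒≡ᵇ≡false {suc x} {zero}  _   = refl
≢⇒≡ᵇ≡false {suc x} {suc j} x≢j = ≢⇒≡ᵇ≡false (x≢j ∘′ cong suc)

boolToℕ : Bool → ℕ
boolToℕ true  = 1
boolToℕ false = 0

countBelow : ℕ → List ℕ → ℕ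
countBelow j []       = 0
countBelow j (x ∷ xs) = boolToℕ (x <ᵇ j) + countBelow j xs

countOf : ℕ → List ℕ → ℕ
countOf j []       = 0
countOf j (x ∷ xs) = boolToℕ (x ≡ᵇ j) + countOf j xs

<ᵇ-suc : ∀ x j → boolToℕ (x <ᵇ suc j) ≡ boolToℕ (x <ᵇ j) + boolToℕ (x ≡ᵇ j)
<ᵇ-suc zero    zero    = refl
<ᵇ-suc zero    (suc j) = refl
<ᵇ-suc (suc x) zero    with x <ᵇ zero
... | _ = refl
<ᵇ-suc (suc x) (suc j) = <ᵇ-suc x j

countBelow-suc : ∀ j xs → countBelow (suc j) xs ≡ countBelow j xs + countOf j xs
countBelow-suc j []       = refl
countBelow-suc j (x ∷ xs) rewrite <ᵇ-suc x j | countBelow-suc j xs =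
  interchange (boolToℕ (x <ᵇ j)) (boolToℕ (x ≡ᵇ j)) (countBelow j xs) (countOf j xs)

countOf-++ : ∀ j xs ys → countOf j (xs ++ ys) ≡ countOf j xs + countOf j ys
countOf-++ j []       ys = refl
countOf-++ j (x ∷ xs) ys rewrite countOf-++ j xs ys = sym (+-assoc (boolToℕ (x ≡ᵇ j)) _ _)

countBelow-≡0 : ∀ {k j xs} → j ≤ k → All (k ≤_) xs → countBelow j xs ≡ 0
countBelow-≡0 _   []                                = refl
countBelow-≡0 {xs = x ∷ _} j≤k (k≤x ∷ ps) rewrite ≥⇒<ᵇ≡false {x} (≤-trans j≤k k≤x) = countBelow-≡0 j≤k ps

countOf-≡0-below : ∀ {k j xs} → j < k → All (k ≤_) xs → countOf j xs ≡ 0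
countOf-≡0-below _   []         = refl
countOf-≡0-below {xs = x ∷ _} j<k (k≤x ∷ ps)
  rewrite ≢⇒≡ᵇ≡false {x} (λ x≡j → <-irrefl (sym x≡j) (<-≤-trans j<k k≤x)) = countOf-≡0-below j<k ps

countOf-≡0-above : ∀ {k j xs} → k < j → All (_≤ k) xs → countOf j xs ≡ 0
countOf-≡0-above _   []         = refl
countOf-≡0-above {xs = x ∷ _} k<j (x≤k ∷ ps)
  rewrite ≢⇒≡ᵇ≡false {x} (λ x≡j → <-irrefl x≡j (≤-<-trans x≤k k<j)) = countOf-≡0-above k<j ps

countBelow-mono : ∀ {i j} xs → i ≤ j → countBelow i xs ≤ countBelow j xs
countBelow-mono             []       _   = z≤n
countBelow-mono {i} {j} (x ∷ xs) i≤j = +-mono-≤ indicator-mono (countBelow-mono xs i≤j)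
  where
  indicator-mono : boolToℕ (x <ᵇ i) ≤ boolToℕ (x <ᵇ j)
  indicator-mono with x <ᵇ i in e
  ... | false = z≤n
  ... | true rewrite <⇒<ᵇ≡true (≤-trans (<ᵇ≡true⇒< x i e) i≤j) = ≤-refl

countOf-replicate : ∀ c y → countOf y (replicate c y) ≡ c
countOf-replicate zero    y = refl
countOf-replicate (suc c) y rewrite ≡ᵇ-refl y = cong suc (countOf-replicate c y)

countOf-replicate-≢ : ∀ c {y j} → y ≢ j → countOf j (replicate c y) ≡ 0
countOf-replicate-≢ zero    _   = refl
countOf-replicate-≢ (suc c) {y} y≢j rewrite ≢⇒≡ᵇ≡false y≢j = countOf-replicate-≢ c y≢j

length≡countBelow : ∀ {k} xs → All (_≤ k) xs → length xs ≡ countBelow (suc k) xs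
length≡countBelow []       []         = refl
length≡countBelow (x ∷ xs) (x≤k ∷ ps) rewrite <⇒<ᵇ≡true (s≤s x≤k) = cong suc (length≡countBelow xs ps)

length≡countOf : ∀ {k} xs → All (k ≤_) xs → All (_≤ k) xs → length xs ≡ countOf k xs
length≡countOf []       []         []         = refl
length≡countOf (x ∷ xs) (k≤x ∷ ps) (x≤k ∷ qs) with ≤-antisym x≤k k≤x
... | refl rewrite ≡ᵇ-refl x = cong suc (length≡countOf xs ps qs)

-- Row insertion

Sorted : List ℕ → Set
Sorted = AllPairs _≤_

-- nothing plays the role of ∞, both for bumps and in the min-plus algebra below.
ℕ∞ : Set
ℕ∞ = Maybe ℕ

rowIns : ℕ → List ℕ → List ℕ
rowIns x r = proj₁ (rowInsert x r)

bump : ℕ → List ℕ → ℕ∞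
bump x r = proj₂ (rowInsert x r)

rowInsert-∷ : ∀ x y ys →
  rowInsert x (y ∷ ys) ≡ (if x <ᵇ y then (x ∷ ys , just y) else (y ∷ rowIns x ys , bump x ys))
rowInsert-∷ x y ys with x <ᵇ y
... | true  = refl
... | false = refl

rowIns-All : ∀ {P : ℕ → Set} x r → All P r → P x → All P (rowIns x r) × All P (fromMaybe (bump x r))
rowIns-All x []       _          px = px ∷ [] , []
rowIns-All x (y ∷ ys) (py ∷ pys) px rewrite rowInsert-∷ x y ys with x <ᵇ y
... | true  = px ∷ pys , py ∷ []
... | false = let (pr , pb) = rowIns-All x ys pys px in py ∷ pr , pb

bump-All : ∀ {P : ℕ → Set} x r → All P r → All P (fromMaybe (bump x r))
bump-All x []       _          = []
bump-All x (y ∷ ys) (py ∷ pys) rewrite rowInsert-∷ x y ys with x <ᵇ y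
... | true  = py ∷ []
... | false = bump-All x ys pys

bump-> : ∀ x r → All (x <_) (fromMaybe (bump x r))
bump-> x []       = []
bump-> x (y ∷ ys) rewrite rowInsert-∷ x y ys with x <ᵇ y in e
... | true  = <ᵇ≡true⇒< x y e ∷ []
... | false = bump-> x ys

rowIns-sorted : ∀ x r → Sorted r → Sorted (rowIns x r)
rowIns-sorted x []       _          = [] ∷ []
rowIns-sorted x (y ∷ ys) (y≤ ∷ sys) rewrite rowInsert-∷ x y ys with x <ᵇ y in e
... | true  = All.map (≤-trans (<⇒≤ (<ᵇ≡true⇒< x y e))) y≤ ∷ sys
... | false = proj₁ (rowIns-All x ys y≤ (<ᵇ≡false⇒≥ x y e)) ∷ rowIns-sorted x ys sys

rowIns-countBelow-≤ : ∀ x r {j} → Sorted r → j ≤ x → countBelow j (rowIns x r) ≡ countBelow j r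
rowIns-countBelow-≤ x []       {j} _          j≤x rewrite ≥⇒<ᵇ≡false j≤x = refl
rowIns-countBelow-≤ x (y ∷ ys) {j} (_ ∷ sys) j≤x rewrite rowInsert-∷ x y ys with x <ᵇ y in e
... | true  rewrite ≥⇒<ᵇ≡false j≤x | ≥⇒<ᵇ≡false {y} (≤-trans j≤x (<⇒≤ (<ᵇ≡true⇒< x y e))) = refl
... | false = cong (boolToℕ (y <ᵇ j) +_) (rowIns-countBelow-≤ x ys sys j≤x)

-- The entries < j form a prefix of the row, and x lands right after the entries ≤ x.
rowIns-countBelow-> : ∀ x r {j} → Sorted r → x < j →
  countBelow j (rowIns x r) ≡ countBelow j r ⊔ suc (countBelow (suc x) r)
rowIns-countBelow-> x []       {j} _          x<j rewrite <⇒<ᵇ≡true x<j = refl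
rowIns-countBelow-> x (y ∷ ys) {j} (y≤ ∷ sys) x<j rewrite rowInsert-∷ x y ys with x <ᵇ y in e
... | true rewrite <⇒<ᵇ≡true x<j | ≥⇒<ᵇ≡false {y} (<ᵇ≡true⇒< x y e)
                 | countBelow-≡0 {xs = ys} (<ᵇ≡true⇒< x y e) y≤ = replaced (y <ᵇ j) refl
  where
  replaced : ∀ b → (y <ᵇ j) ≡ b → suc (countBelow j ys) ≡ (boolToℕ b + countBelow j ys) ⊔ 1
  replaced true  _   = sym (m≥n⇒m⊔n≡m (s≤s z≤n))
  replaced false y≮j rewrite countBelow-≡0 {xs = ys} (<ᵇ≡false⇒≥ y j y≮j) y≤ = refl
... | false rewrite <⇒<ᵇ≡true (≤-<-trans (<ᵇ≡false⇒≥ x y e) x<j) | <⇒<ᵇ≡true (s≤s (<ᵇ≡false⇒≥ x y e))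
  = cong suc (rowIns-countBelow-> x ys sys x<j)

rowIns-countOf : ∀ x r j → countOf j r + boolToℕ (x ≡ᵇ j) ≡ countOf j (rowIns x r) + countOf j (fromMaybe (bump x r))
rowIns-countOf x []       j = trans (sym (+-identityʳ _)) (sym (+-identityʳ _))
rowIns-countOf x (y ∷ ys) j rewrite rowInsert-∷ x y ys with x <ᵇ y
... | true  = swap (boolToℕ (y ≡ᵇ j)) (countOf j ys) (boolToℕ (x ≡ᵇ j))
  where
  swap : ∀ a b c → a + b + c ≡ c + b + (a + 0)
  swap = solve-∀
... | false = trans (+-assoc (boolToℕ (y ≡ᵇ j)) (countOf j ys) _)
                (trans (cong (boolToℕ (y ≡ᵇ j) +_) (rowIns-countOf x ys j)) (sym (+-assoc (boolToℕ (y ≡ᵇ j)) _ _)))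

-- A bump ∞ means that the letter was appended at the end of the row.
_≤∞_ : ℕ∞ → ℕ∞ → Set
nothing ≤∞ m       = m ≡ nothing
just y  ≤∞ nothing = ⊤
just y  ≤∞ just z  = y ≤ z

≤∞-trans : ∀ {a b c} → a ≤∞ b → b ≤∞ c → a ≤∞ c
≤∞-trans {nothing} refl refl = refl
≤∞-trans {just _} {nothing} _   refl = tt
≤∞-trans {just _} {just _} {nothing} _ _ = tt
≤∞-trans {just _} {just _} {just _} p q = ≤-trans p q

bump-mono : ∀ x x' r → Sorted r → x ≤ x' → bump x r ≤∞ bump x' (rowIns x r)
bump-mono x x' []       _          x≤x' rewrite rowInsert-∷ x' x [] | ≥⇒<ᵇ≡false x≤x' = refl
bump-mono x x' (y ∷ ys) (y≤ ∷ sys) x≤x' rewrite rowInsert-∷ x y ys with x <ᵇ y in e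
... | true rewrite rowInsert-∷ x' x ys | ≥⇒<ᵇ≡false x≤x' = bumpedFrom ys (bump-All {P = y ≤_} x' ys y≤)
  where
  bumpedFrom : ∀ zs → All (y ≤_) (fromMaybe (bump x' zs)) → just y ≤∞ bump x' zs
  bumpedFrom zs _ with bump x' zs
  bumpedFrom zs _          | nothing = tt
  bumpedFrom zs (y≤z ∷ []) | just z  = y≤z
... | false rewrite rowInsert-∷ x' y (rowIns x ys) | ≥⇒<ᵇ≡false (≤-trans (<ᵇ≡false⇒≥ x y e) x≤x') =
  bump-mono x x' ys sys x≤x'

insertWord : List ℕ → List ℕ → List ℕ × List ℕ
insertWord []       r = r , []
insertWord (x ∷ xs) r = proj₁ (insertWord xs (rowIns x r)) , fromMaybe (bump x r) ++ proj₂ (insertWord xs (rowIns x r))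

rowInsWord : List ℕ → List ℕ → List ℕ
rowInsWord w r = proj₁ (insertWord w r)

bumpWord : List ℕ → List ℕ → List ℕ
bumpWord w r = proj₂ (insertWord w r)

rowInsWord-sorted : ∀ w r → Sorted r → Sorted (rowInsWord w r)
rowInsWord-sorted []       r sr = sr
rowInsWord-sorted (x ∷ xs) r sr = rowInsWord-sorted xs (rowIns x r) (rowIns-sorted x r sr)

insertWord-All : ∀ {P : ℕ → Set} w r → All P r → All P w → All P (rowInsWord w r) × All P (bumpWord w r)
insertWord-All []       r pr _          = pr , []
insertWord-All (x ∷ xs) r pr (px ∷ pxs) =
  let (pr₁ , pb₁) = rowIns-All x r pr px
      (pr₂ , pb₂) = insertWord-All xs (rowIns x r) pr₁ pxs
  in pr₂ , ++⁺ pb₁ pb₂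

bumpWord-> : ∀ {m} w r → All (m ≤_) w → All (m <_) (bumpWord w r)
bumpWord-> []       r _          = []
bumpWord-> (x ∷ xs) r (m≤x ∷ ps) = ++⁺ (All.map (≤-<-trans m≤x) (bump-> x r)) (bumpWord-> xs (rowIns x r) ps)

insertWord-countOf : ∀ w r j → countOf j r + countOf j w ≡ countOf j (rowInsWord w r) + countOf j (bumpWord w r)
insertWord-countOf []       r j = trans (+-identityʳ _) (sym (+-identityʳ _))
insertWord-countOf (x ∷ xs) r j rewrite countOf-++ j (fromMaybe (bump x r)) (bumpWord xs (rowIns x r)) =
  begin
    countOf j r + (boolToℕ (x ≡ᵇ j) + c)   ≡⟨ sym (+-assoc (countOf j r) _ c) ⟩
    countOf j r + boolToℕ (x ≡ᵇ j) + c     ≡⟨ cong (_+ c) (rowIns-countOf x r j) ⟩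
    countOf j r₁ + b + c                   ≡⟨ xy∙z≈xz∙y (countOf j r₁) b c ⟩
    countOf j r₁ + c + b                   ≡⟨ cong (_+ b) (insertWord-countOf xs r₁ j) ⟩
    countOf j r₂ + countOf j bs + b        ≡⟨ xy∙z≈x∙zy (countOf j r₂) (countOf j bs) b ⟩
    countOf j r₂ + (b + countOf j bs)      ∎
  where
  open ≡-Reasoning
  r₁ = rowIns x r
  r₂ = rowInsWord xs r₁
  bs = bumpWord xs r₁
  b  = countOf j (fromMaybe (bump x r))
  c  = countOf j xs

BoundedBelowBy : ℕ∞ → List ℕ → Set
BoundedBelowBy m = All (λ z → m ≤∞ just z)

bumpWord-bounded : ∀ x w r → Sorted r → Sorted (x ∷ w) → BoundedBelowBy (bump x r) (bumpWord w (rowIns x r))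
bumpWord-bounded x []        r sr _                       = []
bumpWord-bounded x (x' ∷ w) r sr ((x≤x' ∷ _) ∷ sw) =
  ++⁺ (boundsFirst (bump x r) (bump x' (rowIns x r)) first≤next)
      (All.map (≤∞-trans first≤next) (bumpWord-bounded x' w (rowIns x r) (rowIns-sorted x r sr) sw))
  where
  first≤next = bump-mono x x' r sr x≤x'
  boundsFirst : ∀ m m' → m ≤∞ m' → BoundedBelowBy m (fromMaybe m')
  boundsFirst m nothing  _   = []
  boundsFirst m (just _) m≤ = m≤ ∷ []

bumpWord-sorted : ∀ w r → Sorted r → Sorted w → Sorted (bumpWord w r)
bumpWord-sorted []       r _  _          = []
bumpWord-sorted (x ∷ xs) r sr (x≤ ∷ sxs) =
  prepend (bump x r) (bumpWord-bounded x xs r sr (x≤ ∷ sxs)) (bumpWord-sorted xs (rowIns x r) (rowIns-sorted x r sr) sxs)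
  where
  prepend : ∀ m {ys} → BoundedBelowBy m ys → Sorted ys → Sorted (fromMaybe m ++ ys)
  prepend nothing  _  s = s
  prepend (just _) lb s = lb ∷ s

rowInsWord-countBelow-≤ : ∀ w r {j} → All (j ≤_) w → Sorted r → countBelow j (rowInsWord w r) ≡ countBelow j r
rowInsWord-countBelow-≤ []       r _          _  = refl
rowInsWord-countBelow-≤ (x ∷ xs) r (j≤x ∷ ps) sr =
  trans (rowInsWord-countBelow-≤ xs (rowIns x r) ps (rowIns-sorted x r sr)) (rowIns-countBelow-≤ x r sr j≤x)

rowIns-countBelow-mono : ∀ x r j → Sorted r → countBelow j r ≤ countBelow j (rowIns x r)
rowIns-countBelow-mono x r j sr with j ≤? x
... | yes j≤x = ≤-reflexive (sym (rowIns-countBelow-≤ x r sr j≤x))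
... | no  j≰x = ≤-trans (m≤m⊔n _ _) (≤-reflexive (sym (rowIns-countBelow-> x r sr (≰⇒> j≰x))))

rowInsWord-countBelow-mono : ∀ w r j → Sorted r → countBelow j r ≤ countBelow j (rowInsWord w r)
rowInsWord-countBelow-mono []       r j _  = ≤-refl
rowInsWord-countBelow-mono (x ∷ xs) r j sr =
  ≤-trans (rowIns-countBelow-mono x r j sr) (rowInsWord-countBelow-mono xs (rowIns x r) j (rowIns-sorted x r sr))

-- The row is a tandem of queues: the entries < j+1 are the departures from queue j,
-- whose arrivals are the entries < j and whose service demand is the number of j's in w.
countBelow-suc-rowInsWord : ∀ w r j → Sorted r → Sorted w →
  countBelow (suc j) (rowInsWord w r) ≡ (countBelow (suc j) r ⊔ countBelow j (rowInsWord w r)) + countOf j w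
countBelow-suc-rowInsWord [] r j sr _ =
  trans (sym (m≥n⇒m⊔n≡m (countBelow-mono r (n≤1+n j)))) (sym (+-identityʳ _))
countBelow-suc-rowInsWord (x ∷ xs) r j sr (x≤ ∷ sxs) with <-cmp j x
... | tri< j<x _ _ rewrite ≢⇒≡ᵇ≡false {x} {j} (λ x≡j → <-irrefl (sym x≡j) j<x) =
  trans (countBelow-suc-rowInsWord xs r₁ j (rowIns-sorted x r sr) sxs)
        (cong (λ a → (a ⊔ countBelow j (rowInsWord xs r₁)) + countOf j xs) (rowIns-countBelow-≤ x r sr j<x))
  where r₁ = rowIns x r
... | tri≈ _ refl _ rewrite ≡ᵇ-refl j =
  begin
    countBelow (suc j) r₂                      ≡⟨ countBelow-suc-rowInsWord xs r₁ j (rowIns-sorted j r sr) sxs ⟩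
    (countBelow (suc j) r₁ ⊔ B) + c            ≡⟨ cong (λ a → (a ⊔ B) + c) (rowIns-countBelow-> j r sr (n<1+n j)) ⟩
    ((A ⊔ suc A) ⊔ B) + c                      ≡⟨ cong (λ a → (a ⊔ B) + c) (m≤n⇒m⊔n≡n (n≤1+n A)) ⟩
    (suc A ⊔ B) + c                            ≡⟨ cong (_+ c) (m≥n⇒m⊔n≡m (m≤n⇒m≤1+n B≤A)) ⟩
    suc A + c                                  ≡⟨ sym (+-suc A c) ⟩
    A + suc c                                  ≡⟨ cong (_+ suc c) (sym (m≥n⇒m⊔n≡m B≤A)) ⟩
    (A ⊔ B) + suc c                            ∎
  where
  open ≡-Reasoning
  r₁ = rowIns j r
  r₂ = rowInsWord xs r₁
  A = countBelow (suc j) r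
  B = countBelow j r₂
  c = countOf j xs
  B≤A : B ≤ A
  B≤A = ≤-trans (≤-reflexive (trans (rowInsWord-countBelow-≤ xs r₁ x≤ (rowIns-sorted j r sr)) (rowIns-countBelow-≤ j r sr ≤-refl)))
                (countBelow-mono r (n≤1+n j))
... | tri> _ _ x<j rewrite ≢⇒≡ᵇ≡false {x} {j} (λ x≡j → <-irrefl x≡j x<j) =
  begin
    countBelow (suc j) r₂                      ≡⟨ countBelow-suc-rowInsWord xs r₁ j (rowIns-sorted x r sr) sxs ⟩
    (countBelow (suc j) r₁ ⊔ B) + c            ≡⟨ cong (λ a → (a ⊔ B) + c) (rowIns-countBelow-> x r sr (m≤n⇒m≤1+n x<j)) ⟩
    ((A ⊔ C) ⊔ B) + c                          ≡⟨ cong (_+ c) (⊔-assoc A C B) ⟩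
    (A ⊔ (C ⊔ B)) + c                          ≡⟨ cong (λ a → (A ⊔ a) + c) (m≤n⇒m⊔n≡n C≤B) ⟩
    (A ⊔ B) + c                                ∎
  where
  open ≡-Reasoning
  r₁ = rowIns x r
  r₂ = rowInsWord xs r₁
  A = countBelow (suc j) r
  B = countBelow j r₂
  c = countOf j xs
  C = suc (countBelow (suc x) r)
  C≤B : C ≤ B
  C≤B = ≤-trans (m≤n⊔m (countBelow (suc x) r) C)
        (≤-trans (≤-reflexive (sym (rowIns-countBelow-> x r sr (n<1+n x))))
        (≤-trans (countBelow-mono r₁ x<j) (rowInsWord-countBelow-mono xs r₁ j (rowIns-sorted x r sr))))

⊔+-cancel : ∀ {P P' y y' b f} → P' + y' ≡ ((P + y) ⊔ P') + b → f + y' ≡ y + b → f + P ≡ (P + y) ⊓ P'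
⊔+-cancel {P} {P'} {y} {y'} {b} {f} H₂ H₃ with ≤-total (P + y) P'
... | inj₁ P+y≤P' = begin
  f + P        ≡⟨ cong (_+ P) (+-cancelʳ-≡ y' f y (trans H₃ (cong (y +_) (sym y'≡b)))) ⟩
  y + P        ≡⟨ +-comm y P ⟩
  P + y        ≡⟨ sym (m≤n⇒m⊓n≡m P+y≤P') ⟩
  (P + y) ⊓ P' ∎
  where
  open ≡-Reasoning
  y'≡b : y' ≡ b
  y'≡b = +-cancelˡ-≡ P' y' b (trans H₂ (cong (_+ b) (m≤n⇒m⊔n≡n P+y≤P')))
... | inj₂ P'≤P+y = trans P'≡ (sym (m≥n⇒m⊓n≡n P'≤P+y))
  where
  open ≡-Reasoning
  P'≡ : f + P ≡ P'
  P'≡ = +-cancelʳ-≡ y' _ _ (begin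
    f + P + y'   ≡⟨ xy∙z≈y∙xz f P y' ⟩
    P + (f + y') ≡⟨ cong (P +_) H₃ ⟩
    P + (y + b)  ≡⟨ sym (+-assoc P y b) ⟩
    P + y + b    ≡⟨ sym (cong (_+ b) (m≥n⇒m⊔n≡m P'≤P+y)) ⟩
    ((P + y) ⊔ P') + b ≡⟨ sym H₂ ⟩
    P' + y' ∎)

⊓-exchange : ∀ {P A' x' y b f} → A' + x' ≡ (P ⊔ A') + b → f + P ≡ (P + y) ⊓ (A' + x') → f ⊓ x' ≡ y ⊓ b
⊓-exchange {P} {A'} {x'} {y} {b} {f} H₁ H with ≤-total A' P
... | inj₁ A'≤P = begin
  f ⊓ x'       ≡⟨ cong (_⊓ x') f≡ ⟩
  y ⊓ b ⊓ x'   ≡⟨ ⊓-assoc y b x' ⟩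
  y ⊓ (b ⊓ x') ≡⟨ cong (y ⊓_) (m≤n⇒m⊓n≡m b≤x') ⟩
  y ⊓ b        ∎
  where
  open ≡-Reasoning
  H₁' : A' + x' ≡ P + b
  H₁' = trans H₁ (cong (_+ b) (m≥n⇒m⊔n≡m A'≤P))
  b≤x' : b ≤ x'
  b≤x' = +-cancelˡ-≤ A' b x' (≤-trans (+-monoˡ-≤ b A'≤P) (≤-reflexive (sym H₁')))
  f≡ : f ≡ y ⊓ b
  f≡ = +-cancelˡ-≡ P f (y ⊓ b) (trans (+-comm P f) (trans H (trans (cong ((P + y) ⊓_) H₁') (sym (+-distribˡ-⊓ P y b)))))
... | inj₂ P≤A' = begin
  f ⊓ x'             ≡⟨ cong₂ _⊓_ f≡ x'≡b ⟩
  y ⊓ (d + b) ⊓ b    ≡⟨ ⊓-assoc y (d + b) b ⟩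
  y ⊓ ((d + b) ⊓ b)  ≡⟨ cong (y ⊓_) (m≥n⇒m⊓n≡n (m≤n+m b d)) ⟩
  y ⊓ b              ∎
  where
  open ≡-Reasoning
  d = A' ∸ P
  x'≡b : x' ≡ b
  x'≡b = +-cancelˡ-≡ A' x' b (trans H₁ (cong (_+ b) (m≤n⇒m⊔n≡n P≤A')))
  A'+x'≡ : A' + x' ≡ P + (d + b)
  A'+x'≡ = trans (cong₂ _+_ (sym (m+[n∸m]≡n P≤A')) x'≡b) (+-assoc P d b)
  f≡ : f ≡ y ⊓ (d + b)
  f≡ = +-cancelˡ-≡ P f _ (trans (+-comm P f) (trans H (trans (cong ((P + y) ⊓_) A'+x'≡) (sym (+-distribˡ-⊓ P y (d + b))))))

bumpWord-countOf-suc : ∀ w r j → Sorted r → Sorted w →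
  countOf (suc j) (bumpWord w r) + countBelow (suc j) r ≡ countBelow (suc (suc j)) r ⊓ countBelow (suc j) (rowInsWord w r)
bumpWord-countOf-suc w r j sr sw =
  trans (⊔+-cancel H₂ H₃) (cong (_⊓ countBelow (suc j) r') (sym (countBelow-suc (suc j) r)))
  where
  r' = rowInsWord w r
  H₂ : countBelow (suc j) r' + countOf (suc j) r' ≡
       ((countBelow (suc j) r + countOf (suc j) r) ⊔ countBelow (suc j) r') + countOf (suc j) w
  H₂ = begin
    countBelow (suc j) r' + countOf (suc j) r'                           ≡⟨ sym (countBelow-suc (suc j) r') ⟩
    countBelow (suc (suc j)) r'                                          ≡⟨ countBelow-suc-rowInsWord w r (suc j) sr sw ⟩
    (countBelow (suc (suc j)) r ⊔ countBelow (suc j) r') + countOf (suc j) w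
      ≡⟨ cong (λ a → (a ⊔ countBelow (suc j) r') + countOf (suc j) w) (countBelow-suc (suc j) r) ⟩
    ((countBelow (suc j) r + countOf (suc j) r) ⊔ countBelow (suc j) r') + countOf (suc j) w ∎
    where open ≡-Reasoning
  H₃ : countOf (suc j) (bumpWord w r) + countOf (suc j) r' ≡ countOf (suc j) r + countOf (suc j) w
  H₃ = trans (+-comm (countOf (suc j) (bumpWord w r)) _) (sym (insertWord-countOf w r (suc j)))

bumpWord-countOf-⊓ : ∀ w r j → Sorted r → Sorted w →
  countOf (suc j) (bumpWord w r) ⊓ countOf j (rowInsWord w r) ≡ countOf (suc j) r ⊓ countOf j w
bumpWord-countOf-⊓ w r j sr sw = ⊓-exchange H₁ H
  where
  r' = rowInsWord w r
  H₁ : countBelow j r' + countOf j r' ≡ (countBelow (suc j) r ⊔ countBelow j r') + countOf j w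
  H₁ = trans (sym (countBelow-suc j r')) (countBelow-suc-rowInsWord w r j sr sw)
  H : countOf (suc j) (bumpWord w r) + countBelow (suc j) r ≡
      (countBelow (suc j) r + countOf (suc j) r) ⊓ (countBelow j r' + countOf j r')
  H = trans (bumpWord-countOf-suc w r j sr sw) (cong₂ _⊓_ (countBelow-suc (suc j) r) (countBelow-suc j r'))

bumpWord-countOf-≡0 : ∀ m w r → All (m ≤_) w → countOf m (bumpWord w r) ≡ 0
bumpWord-countOf-≡0 m w r m≤w = countOf-≡0-below (n<1+n m) (bumpWord-> w r m≤w)

rowInsWord-countOf-least : ∀ m w r → All (m ≤_) w → countOf m (rowInsWord w r) ≡ countOf m r + countOf m w
rowInsWord-countOf-least m w r m≤w =
  trans (sym (+-identityʳ _)) (trans (cong (countOf m (rowInsWord w r) +_) (sym (bumpWord-countOf-≡0 m w r m≤w)))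
                                     (sym (insertWord-countOf w r m)))

bumpWord-countOf-suc≤ : ∀ m w r → All (m ≤_) r → All (m ≤_) w → Sorted r → Sorted w →
  countOf (suc m) (bumpWord w r) ≤ countOf m w
bumpWord-countOf-suc≤ m w r m≤r m≤w sr sw = +-cancelʳ-≤ (countOf m r) _ _ (begin
  countOf (suc m) (bumpWord w r) + countOf m r          ≡⟨ cong (countOf (suc m) (bumpWord w r) +_) (sym (countBelow-suc-least r m≤r)) ⟩
  countOf (suc m) (bumpWord w r) + countBelow (suc m) r ≡⟨ bumpWord-countOf-suc w r m sr sw ⟩
  countBelow (suc (suc m)) r ⊓ countBelow (suc m) r'    ≤⟨ m⊓n≤n _ _ ⟩
  countBelow (suc m) r'                                 ≡⟨ countBelow-suc-least r' (proj₁ (insertWord-All w r m≤r m≤w)) ⟩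
  countOf m r'                                          ≡⟨ rowInsWord-countOf-least m w r m≤w ⟩
  countOf m r + countOf m w                             ≡⟨ +-comm (countOf m r) _ ⟩
  countOf m w + countOf m r                             ∎)
  where
  open ≤-Reasoning
  r' = rowInsWord w r
  countBelow-suc-least : ∀ xs → All (m ≤_) xs → countBelow (suc m) xs ≡ countOf m xs
  countBelow-suc-least xs m≤xs = trans (countBelow-suc m xs) (cong (_+ countOf m xs) (countBelow-≡0 ≤-refl m≤xs))

headRow : Tableau → List ℕ
headRow []      = []
headRow (r ∷ _) = r

tailRows : Tableau → Tableau
tailRows []       = []
tailRows (_ ∷ rs) = rs

row : Tableau → ℕ → List ℕ
row T zero    = headRow T
row T (suc i) = row (tailRows T) i

shapePart≡length-row : ∀ T k → shapePart T (suc k) ≡ length (row T k)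
shapePart≡length-row []       zero    = refl
shapePart≡length-row []       (suc k) = shapePart≡length-row [] k
shapePart≡length-row (r ∷ rs) zero    = refl
shapePart≡length-row (r ∷ rs) (suc k) = shapePart≡length-row rs k

insertAll-++ : ∀ xs ys T → insertAll (xs ++ ys) T ≡ insertAll ys (insertAll xs T)
insertAll-++ []       ys T = refl
insertAll-++ (x ∷ xs) ys T = insertAll-++ xs ys (insert x T)

insert-headRow : ∀ x T → headRow (insert x T) ≡ rowIns x (headRow T)
insert-headRow x []       = refl
insert-headRow x (r ∷ rs) with rowInsert x r
... | _ , nothing = refl
... | _ , just _  = refl

insert-tailRows : ∀ x T → tailRows (insert x T) ≡ insertAll (fromMaybe (bump x (headRow T))) (tailRows T)
insert-tailRows x []       = refl
insert-tailRows x (r ∷ rs) with rowInsert x r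
... | _ , nothing = refl
... | _ , just _  = refl

insertAll-headRow : ∀ w T → headRow (insertAll w T) ≡ rowInsWord w (headRow T)
insertAll-headRow []       T = refl
insertAll-headRow (x ∷ xs) T = trans (insertAll-headRow xs (insert x T)) (cong (rowInsWord xs) (insert-headRow x T))

insertAll-tailRows : ∀ w T → tailRows (insertAll w T) ≡ insertAll (bumpWord w (headRow T)) (tailRows T)
insertAll-tailRows []       T = refl
insertAll-tailRows (x ∷ xs) T = begin
  tailRows (insertAll xs (insert x T))
    ≡⟨ insertAll-tailRows xs (insert x T) ⟩
  insertAll (bumpWord xs (headRow (insert x T))) (tailRows (insert x T))
    ≡⟨ cong₂ (λ r U → insertAll (bumpWord xs r) U) (insert-headRow x T) (insert-tailRows x T) ⟩
  insertAll (bumpWord xs (rowIns x (headRow T))) (insertAll (fromMaybe (bump x (headRow T))) (tailRows T))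
    ≡⟨ sym (insertAll-++ (fromMaybe (bump x (headRow T))) _ (tailRows T)) ⟩
  insertAll (bumpWord (x ∷ xs) (headRow T)) (tailRows T) ∎
  where open ≡-Reasoning

insert-All : ∀ {P : ℕ → Set} {x} T → All (All P) T → P x → All (All P) (insert x T)
insert-All         []       _          px = (px ∷ []) ∷ []
insert-All {x = x} (r ∷ rs) (pr ∷ prs) px with rowInsert x r | rowIns-All x r pr px
... | _ , nothing | pr' , _        = pr' ∷ prs
... | _ , just _  | pr' , py ∷ []  = pr' ∷ insert-All rs prs py

insertAll-All : ∀ {P : ℕ → Set} w T → All (All P) T → All P w → All (All P) (insertAll w T)
insertAll-All []       T pT _          = pT
insertAll-All (x ∷ xs) T pT (px ∷ pxs) = insertAll-All xs (insert x T) (insert-All T pT px) pxs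

Staircase : ℕ → ℕ → Tableau → Set
Staircase m zero    T = ⊤
Staircase m (suc n) T = Sorted (headRow T) × All (m ≤_) (headRow T) × Staircase (suc m) n (tailRows T)

Staircase-[] : ∀ m n → Staircase m n []
Staircase-[] m zero    = tt
Staircase-[] m (suc n) = [] , [] , Staircase-[] (suc m) n

Staircase-insertAll : ∀ m n w T → Sorted w → All (m ≤_) w → Staircase m n T → Staircase m n (insertAll w T)
Staircase-insertAll m zero    w T _  _   _ = tt
Staircase-insertAll m (suc n) w T sw m≤w (sr , m≤r , st) rewrite insertAll-headRow w T | insertAll-tailRows w T =
  rowInsWord-sorted w (headRow T) sr ,
  proj₁ (insertWord-All w (headRow T) m≤r m≤w) ,
  Staircase-insertAll (suc m) n (bumpWord w (headRow T)) (tailRows T)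
    (bumpWord-sorted w (headRow T) sr sw) (bumpWord-> w (headRow T) m≤w) st

Staircase-row : ∀ m n T i → i < n → Staircase m n T → All (m + i ≤_) (row T i)
Staircase-row m (suc n) T zero    _         (_ , m≤r , _) = subst (λ k → All (k ≤_) (headRow T)) (sym (+-identityʳ m)) m≤r
Staircase-row m (suc n) T (suc i) (s≤s i<n) (_ , _ , st)  =
  subst (λ k → All (k ≤_) (row T (suc i))) (sym (+-suc m i)) (Staircase-row (suc m) n (tailRows T) i i<n st)

-- A consequence of column strictness.
DiagonalDecreasing : ℕ → ℕ → Tableau → Set
DiagonalDecreasing m zero          T = ⊤
DiagonalDecreasing m (suc zero)    T = ⊤
DiagonalDecreasing m (suc (suc n)) T =
  countOf (suc m) (headRow (tailRows T)) ≤ countOf m (headRow T) × DiagonalDecreasing (suc m) (suc n) (tailRows T)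

DiagonalDecreasing-[] : ∀ m n → DiagonalDecreasing m n []
DiagonalDecreasing-[] m zero          = tt
DiagonalDecreasing-[] m (suc zero)    = tt
DiagonalDecreasing-[] m (suc (suc n)) = z≤n , DiagonalDecreasing-[] (suc m) (suc n)

DiagonalDecreasing-insertAll : ∀ m n w T → Sorted w → All (m ≤_) w → Staircase m n T →
  DiagonalDecreasing m n T → DiagonalDecreasing m n (insertAll w T)
DiagonalDecreasing-insertAll m zero          w T _ _ _ _ = tt
DiagonalDecreasing-insertAll m (suc zero)    w T _ _ _ _ = tt
DiagonalDecreasing-insertAll m (suc (suc n)) w T sw m≤w (sr , m≤r , st) (d , dd) =
  subst₂ _≤_ (cong (countOf (suc m)) (sym top₁)) (cong (countOf m) (sym (insertAll-headRow w T))) (begin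
    countOf (suc m) (rowInsWord bs r₁)      ≡⟨ rowInsWord-countOf-least (suc m) bs r₁ (bumpWord-> w r m≤w) ⟩
    countOf (suc m) r₁ + countOf (suc m) bs ≤⟨ +-mono-≤ d (bumpWord-countOf-suc≤ m w r m≤r m≤w sr sw) ⟩
    countOf m r + countOf m w               ≡⟨ sym (rowInsWord-countOf-least m w r m≤w) ⟩
    countOf m (rowInsWord w r)              ∎) ,
  subst (DiagonalDecreasing (suc m) (suc n)) (sym (insertAll-tailRows w T))
    (DiagonalDecreasing-insertAll (suc m) (suc n) bs (tailRows T) (bumpWord-sorted w r sr sw) (bumpWord-> w r m≤w) st dd)
  where
  open ≤-Reasoning
  r = headRow T
  r₁ = headRow (tailRows T)
  bs = bumpWord w r
  top₁ : headRow (tailRows (insertAll w T)) ≡ rowInsWord bs r₁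
  top₁ = trans (cong headRow (insertAll-tailRows w T)) (insertAll-headRow bs (tailRows T))

-- Min-plus selections

infixl 6 _⊓∞_
infixl 7 _+∞_

_⊓∞_ : ℕ∞ → ℕ∞ → ℕ∞
nothing ⊓∞ b       = b
just a  ⊓∞ nothing = just a
just a  ⊓∞ just b  = just (a ⊓ b)

_+∞_ : ℕ∞ → ℕ → ℕ∞
nothing +∞ _ = nothing
just a  +∞ c = just (a + c)

⊓∞-assoc : ∀ a b c → a ⊓∞ b ⊓∞ c ≡ a ⊓∞ (b ⊓∞ c)
⊓∞-assoc nothing  b        c        = refl
⊓∞-assoc (just a) nothing  c        = refl
⊓∞-assoc (just a) (just b) nothing  = refl
⊓∞-assoc (just a) (just b) (just c) = cong just (⊓-assoc a b c)

⊓∞-zeroʳ : ∀ a → a ⊓∞ just 0 ≡ just 0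
⊓∞-zeroʳ nothing  = refl
⊓∞-zeroʳ (just a) = cong just (⊓-zeroʳ a)

+∞-assoc : ∀ a b c → a +∞ b +∞ c ≡ a +∞ (b + c)
+∞-assoc nothing  b c = refl
+∞-assoc (just a) b c = cong just (+-assoc a b c)

+∞-distribʳ-⊓∞ : ∀ a b c → (a ⊓∞ b) +∞ c ≡ a +∞ c ⊓∞ b +∞ c
+∞-distribʳ-⊓∞ nothing  b        c = refl
+∞-distribʳ-⊓∞ (just a) nothing  c = refl
+∞-distribʳ-⊓∞ (just a) (just b) c = cong just (+-distribʳ-⊓ c a b)

+∞-distribˡ-⊓ : ∀ a b c → a +∞ b ⊓∞ a +∞ c ≡ a +∞ (b ⊓ c)
+∞-distribˡ-⊓ nothing  b c = refl
+∞-distribˡ-⊓ (just a) b c = cong just (sym (+-distribˡ-⊓ a b c))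

⊓∞-+∞-normalise : ∀ P Q H a b c →
  P ⊓∞ Q +∞ a ⊓∞ (Q ⊓∞ H +∞ b) +∞ c ≡ P ⊓∞ Q +∞ (a ⊓ c) ⊓∞ H +∞ (b + c)
⊓∞-+∞-normalise P Q H a b c = begin
  P ⊓∞ Q +∞ a ⊓∞ (Q ⊓∞ H +∞ b) +∞ c           ≡⟨ cong (P ⊓∞ Q +∞ a ⊓∞_) (+∞-distribʳ-⊓∞ Q (H +∞ b) c) ⟩
  P ⊓∞ Q +∞ a ⊓∞ (Q +∞ c ⊓∞ H +∞ b +∞ c)      ≡⟨ cong (λ h → P ⊓∞ Q +∞ a ⊓∞ (Q +∞ c ⊓∞ h)) (+∞-assoc H b c) ⟩
  P ⊓∞ Q +∞ a ⊓∞ (Q +∞ c ⊓∞ H +∞ (b + c))     ≡⟨ sym (⊓∞-assoc (P ⊓∞ Q +∞ a) (Q +∞ c) _) ⟩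
  P ⊓∞ Q +∞ a ⊓∞ Q +∞ c ⊓∞ H +∞ (b + c)       ≡⟨ cong (λ p → p ⊓∞ H +∞ (b + c)) (⊓∞-assoc P (Q +∞ a) (Q +∞ c)) ⟩
  P ⊓∞ (Q +∞ a ⊓∞ Q +∞ c) ⊓∞ H +∞ (b + c)     ≡⟨ cong (λ q → P ⊓∞ q ⊓∞ H +∞ (b + c)) (+∞-distribˡ-⊓ Q a c) ⟩
  P ⊓∞ Q +∞ (a ⊓ c) ⊓∞ H +∞ (b + c)           ∎
  where open ≡-Reasoning

-- minSelection m n T a is the minimum, over rows i₁ < … < i_a among the first n,
-- of Σₖ #(m + iₖ + a − k) in row iₖ; it is ∞ when a > n.
minSelection : ℕ → ℕ → Tableau → ℕ → ℕ∞
minSelection m n       T zero    = just 0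
minSelection m zero    T (suc a) = nothing
minSelection m (suc n) T (suc a) =
  minSelection (suc m) n (tailRows T) (suc a) ⊓∞ minSelection (suc m) n (tailRows T) a +∞ countOf (m + a) (headRow T)

minSelection-insertAll : ∀ m n w T → Staircase m n T → Sorted w → All (m ≤_) w → ∀ a →
  minSelection m n (insertAll w T) (suc a) ≡
  minSelection m n T (suc (suc a)) ⊓∞ minSelection m n T (suc a) +∞ countOf (m + a) w
minSelection-insertAll m zero    w T _             _  _   a = refl
minSelection-insertAll m (suc n) w T (sr , _ , st) sw m≤w a
  rewrite insertAll-headRow w T | insertAll-tailRows w T = begin
    S' (suc a) ⊓∞ S' a +∞ countOf (m + a) r'
      ≡⟨ cong₂ (λ p q → p ⊓∞ q +∞ countOf (m + a) r') (S'-step (suc a)) (S'-step a) ⟩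
    g (2 + a) ⊓∞ g (1 + a) +∞ countOf (m + suc a) bs ⊓∞ (g (suc a) ⊓∞ g a +∞ countOf (m + a) bs) +∞ countOf (m + a) r'
      ≡⟨ ⊓∞-+∞-normalise (g (2 + a)) (g (1 + a)) (g a) _ _ _ ⟩
    g (2 + a) ⊓∞ g (1 + a) +∞ (countOf (m + suc a) bs ⊓ countOf (m + a) r') ⊓∞ g a +∞ (countOf (m + a) bs + countOf (m + a) r')
      ≡⟨ cong₂ (λ p q → g (2 + a) ⊓∞ g (1 + a) +∞ p ⊓∞ g a +∞ q) exchange conservation ⟩
    g (2 + a) ⊓∞ g (1 + a) +∞ (countOf (m + suc a) r ⊓ countOf (m + a) w) ⊓∞ g a +∞ (countOf (m + a) r + countOf (m + a) w)
      ≡⟨ sym (⊓∞-+∞-normalise (g (2 + a)) (g (1 + a)) (g a) _ _ _) ⟩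
    g (2 + a) ⊓∞ g (1 + a) +∞ countOf (m + suc a) r ⊓∞ (g (suc a) ⊓∞ g a +∞ countOf (m + a) r) +∞ countOf (m + a) w ∎
  where
  open ≡-Reasoning
  r  = headRow T
  bs = bumpWord w r
  r' = rowInsWord w r
  g  = minSelection (suc m) n (tailRows T)
  S' = minSelection (suc m) n (insertAll bs (tailRows T))
  S'-step : ∀ a → S' a ≡ g (suc a) ⊓∞ g a +∞ countOf (m + a) bs
  S'-step zero    = sym (trans (cong (λ c → g 1 ⊓∞ just c) (bumpWord-countOf-≡0 (m + 0) w r (subst (λ k → All (k ≤_) w) (sym (+-identityʳ m)) m≤w)))
                               (⊓∞-zeroʳ (g 1)))
  S'-step (suc a) = trans (minSelection-insertAll (suc m) n bs (tailRows T) st (bumpWord-sorted w r sr sw) (bumpWord-> w r m≤w) a)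
                          (cong (λ k → g (2 + a) ⊓∞ g (1 + a) +∞ countOf k bs) (sym (+-suc m a)))
  exchange : countOf (m + suc a) bs ⊓ countOf (m + a) r' ≡ countOf (m + suc a) r ⊓ countOf (m + a) w
  exchange rewrite +-suc m a = bumpWord-countOf-⊓ w r (m + a) sr sw
  conservation : countOf (m + a) bs + countOf (m + a) r' ≡ countOf (m + a) r + countOf (m + a) w
  conservation = trans (+-comm (countOf (m + a) bs) _) (sym (insertWord-countOf w r (m + a)))

minSelection-∞ : ∀ m n T a → n < a → minSelection m n T a ≡ nothing
minSelection-∞ m zero    T (suc a) _ = refl
minSelection-∞ m (suc n) T (suc a) (s≤s n<a)
  rewrite minSelection-∞ (suc m) n (tailRows T) (suc a) (m≤n⇒m≤1+n n<a) | minSelection-∞ (suc m) n (tailRows T) a n<a = refl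

minSelection-[] : ∀ m n a → a ≤ n → minSelection m n [] a ≡ just 0
minSelection-[] m n       zero    _ = refl
minSelection-[] m (suc n) (suc a) (s≤s a≤n) with m≤n⇒m<n∨m≡n a≤n
... | inj₁ a<n  rewrite minSelection-[] (suc m) n (suc a) a<n | minSelection-[] (suc m) n a a≤n = refl
... | inj₂ refl rewrite minSelection-∞ (suc m) a [] (suc a) (n<1+n a) | minSelection-[] (suc m) a a ≤-refl = refl

DiagonalDecreasing-row≤ : ∀ m n T → DiagonalDecreasing m (suc n) T → countOf (m + n) (row T n) ≤ countOf m (headRow T)
DiagonalDecreasing-row≤ m zero    T _        = ≤-reflexive (cong (λ k → countOf k (headRow T)) (+-identityʳ m))
DiagonalDecreasing-row≤ m (suc n) T (d , dd) =
  ≤-trans (≤-reflexive (cong (λ k → countOf k (row T (suc n))) (+-suc m n)))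
          (≤-trans (DiagonalDecreasing-row≤ (suc m) n (tailRows T) dd) d)

minSelection-one : ∀ m n T → DiagonalDecreasing m (suc n) T → minSelection m (suc n) T 1 ≡ just (countOf (m + n) (row T n))
minSelection-one m zero    T _        = refl
minSelection-one m (suc n) T (d , dd) rewrite minSelection-one (suc m) n (tailRows T) dd | +-identityʳ m | sym (+-suc m n) =
  cong just (m≤n⇒m⊓n≡m (DiagonalDecreasing-row≤ m (suc n) T (d , dd)))

concat-map-∷ʳ : ∀ {A B : Set} (f : A → List B) xs y → concat (map f (xs ∷ʳ y)) ≡ concat (map f xs) ++ f y
concat-map-∷ʳ f xs y = begin
  concat (map f (xs ∷ʳ y))        ≡⟨ cong concat (map-++ f xs (y ∷ [])) ⟩
  concat (map f xs ++ f y ∷ [])   ≡⟨ sym (concat-++ (map f xs) (f y ∷ [])) ⟩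
  concat (map f xs) ++ f y ++ []  ≡⟨ cong (concat (map f xs) ++_) (++-identityʳ (f y)) ⟩
  concat (map f xs) ++ f y        ∎
  where open ≡-Reasoning

block : Array → ℕ → ℕ → List ℕ
block u i K = concat (map (λ j → replicate (u i j) j) (from1 K))

block-suc : ∀ u i K → block u i (suc K) ≡ block u i K ++ replicate (u i (suc K)) (suc K)
block-suc u i K = concat-map-∷ʳ (λ j → replicate (u i j) j) (from1 K) (suc K)

rsk-word-suc : ∀ u K n → rsk (word u K (suc n)) ≡ insertAll (block u (suc n) K) (rsk (word u K n))
rsk-word-suc u K n =
  trans (cong (λ w → insertAll w []) (concat-map-∷ʳ (λ i → block u i K) (from1 n) (suc n)))
        (insertAll-++ (word u K n) (block u (suc n) K) [])

block-≤ : ∀ u i K → All (_≤ K) (block u i K)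
block-≤ u i zero    = []
block-≤ u i (suc K) rewrite block-suc u i K =
  ++⁺ (All.map (λ j≤K → m≤n⇒m≤1+n j≤K) (block-≤ u i K)) (replicate⁺ (u i (suc K)) ≤-refl)

block-≥1 : ∀ u i K → All (1 ≤_) (block u i K)
block-≥1 u i zero    = []
block-≥1 u i (suc K) rewrite block-suc u i K = ++⁺ (block-≥1 u i K) (replicate⁺ (u i (suc K)) (s≤s z≤n))

block-sorted : ∀ u i K → Sorted (block u i K)
block-sorted u i zero    = []
block-sorted u i (suc K) rewrite block-suc u i K =
  AllPairs.++⁺ (block-sorted u i K) (replicate-sorted (u i (suc K)))
    (All.map (λ j≤K → replicate⁺ (u i (suc K)) (m≤n⇒m≤1+n j≤K)) (block-≤ u i K))
  where
  replicate-sorted : ∀ c → Sorted (replicate c (suc K))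
  replicate-sorted zero    = []
  replicate-sorted (suc c) = replicate⁺ c ≤-refl ∷ replicate-sorted c

block-countOf : ∀ u i K j → 1 ≤ j → j ≤ K → countOf j (block u i K) ≡ u i j
block-countOf u i zero    zero    () _
block-countOf u i zero    (suc j) _  ()
block-countOf u i (suc K) j 1≤j j≤1+K rewrite block-suc u i K | countOf-++ j (block u i K) (replicate (u i (suc K)) (suc K))
  with m≤n⇒m<n∨m≡n j≤1+K
... | inj₁ (s≤s j≤K) rewrite block-countOf u i K j 1≤j j≤K
                           | countOf-replicate-≢ (u i (suc K)) (λ 1+K≡j → <-irrefl (sym 1+K≡j) (s≤s j≤K)) = +-identityʳ _
... | inj₂ refl      rewrite countOf-≡0-above (n<1+n K) (block-≤ u i K) = countOf-replicate (u i (suc K)) (suc K)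

rsk-word-Staircase : ∀ u K N n → Staircase 1 n (rsk (word u K N))
rsk-word-Staircase u K zero    n = Staircase-[] 1 n
rsk-word-Staircase u K (suc N) n rewrite rsk-word-suc u K N =
  Staircase-insertAll 1 n (block u (suc N) K) _ (block-sorted u (suc N) K) (block-≥1 u (suc N) K) (rsk-word-Staircase u K N n)

rsk-word-DiagonalDecreasing : ∀ u K N n → DiagonalDecreasing 1 n (rsk (word u K N))
rsk-word-DiagonalDecreasing u K zero    n = DiagonalDecreasing-[] 1 n
rsk-word-DiagonalDecreasing u K (suc N) n rewrite rsk-word-suc u K N =
  DiagonalDecreasing-insertAll 1 n (block u (suc N) K) _ (block-sorted u (suc N) K) (block-≥1 u (suc N) K)
    (rsk-word-Staircase u K N n) (rsk-word-DiagonalDecreasing u K N n)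

rsk-word-≤ : ∀ u K N → All (All (_≤ K)) (rsk (word u K N))
rsk-word-≤ u K zero    = []
rsk-word-≤ u K (suc N) rewrite rsk-word-suc u K N = insertAll-All (block u (suc N) K) _ (rsk-word-≤ u K N) (block-≤ u (suc N) K)

All-row : ∀ {P : ℕ → Set} T → All (All P) T → ∀ i → All P (row T i)
All-row []       _          zero    = []
All-row []       p          (suc i) = All-row [] p i
All-row (r ∷ rs) (pr ∷ _)   zero    = pr
All-row (r ∷ rs) (_  ∷ prs) (suc i) = All-row rs prs i

Dq≡countBelow : ∀ u K n j → j ≤ K → Dq u n j ≡ countBelow (suc j) (headRow (rsk (word u K n)))
Dq≡countBelow u K zero    j       _   = refl
Dq≡countBelow u K (suc n) zero    _   = sym (countBelow-≡0 ≤-refl (proj₁ (proj₂ (rsk-word-Staircase u K (suc n) 1))))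
Dq≡countBelow u K (suc n) (suc j) j<K = begin
  (Dq u n (suc j) ⊔ Dq u (suc n) j) + u (suc n) (suc j)
    ≡⟨ cong₂ (λ a b → (a ⊔ b) + u (suc n) (suc j)) (Dq≡countBelow u K n (suc j) j<K)
             (trans (Dq≡countBelow u K (suc n) j (<⇒≤ j<K)) (cong (countBelow (suc j)) next)) ⟩
  (countBelow (suc (suc j)) r ⊔ countBelow (suc j) (rowInsWord w r)) + u (suc n) (suc j)
    ≡⟨ cong ((countBelow (suc (suc j)) r ⊔ countBelow (suc j) (rowInsWord w r)) +_) (sym (block-countOf u (suc n) K (suc j) (s≤s z≤n) j<K)) ⟩
  (countBelow (suc (suc j)) r ⊔ countBelow (suc j) (rowInsWord w r)) + countOf (suc j) w
    ≡⟨ sym (countBelow-suc-rowInsWord w r (suc j) (proj₁ (rsk-word-Staircase u K n 1)) (block-sorted u (suc n) K)) ⟩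
  countBelow (suc (suc j)) (rowInsWord w r)
    ≡⟨ cong (countBelow (suc (suc j))) (sym next) ⟩
  countBelow (suc (suc j)) (headRow (rsk (word u K (suc n)))) ∎
  where
  open ≡-Reasoning
  r = headRow (rsk (word u K n))
  w = block u (suc n) K
  next : headRow (rsk (word u K (suc n))) ≡ rowInsWord w r
  next = trans (cong headRow (rsk-word-suc u K n)) (insertAll-headRow w _)

firstPart≡Dq : ∀ u K N → shapePart (rsk (word u K N)) 1 ≡ Dq u N K
firstPart≡Dq u K N = begin
  shapePart (rsk (word u K N)) 1  ≡⟨ shapePart≡length-row (rsk (word u K N)) 0 ⟩
  length r                         ≡⟨ length≡countBelow r (All-row _ (rsk-word-≤ u K N) 0) ⟩
  countBelow (suc K) r             ≡⟨ sym (Dq≡countBelow u K N K ≤-refl) ⟩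
  Dq u N K                         ∎
  where
  open ≡-Reasoning
  r = headRow (rsk (word u K N))

-- Stores

departures : Array → ℕ → ℕ → ℕ → ℕ
departures u K m zero    = 0
departures u K m (suc n) = departures u K m n + proj₂ (store u K m (suc n))

-- Conservation of goods: the output of store m+1 up to slot n has left store m+2
-- by slot n, is in its stock, or is delivered to it at slot n+1.
departures-inflow : ∀ u K m n →
  departures u K (suc m) n + (proj₁ (store u K (suc m) n) + proj₂ (store u K m n)) ≡ departures u K m n
departures-inflow u K zero    zero    = refl
departures-inflow u K (suc m) zero    = refl
departures-inflow u K m       (suc n) = begin
  C + r + (L + S ∸ r + S')   ≡⟨ regroup C r (L + S ∸ r) S' ⟩
  C + (L + S ∸ r + r) + S'   ≡⟨ cong (λ x → C + x + S') (m∸n+n≡m (m⊓n≤m (L + S) (u (suc n) (K ∸ suc m)))) ⟩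
  C + (L + S) + S'           ≡⟨ cong (_+ S') (departures-inflow u K m n) ⟩
  departures u K m n + S'    ∎
  where
  open ≡-Reasoning
  C  = departures u K (suc m) n
  L  = proj₁ (store u K (suc m) n)
  S  = proj₂ (store u K m n)
  S' = proj₂ (store u K m (suc n))
  r  = (L + S) ⊓ u (suc n) (K ∸ suc m)
  regroup : ∀ a b c d → a + b + (c + d) ≡ a + (c + b) + d
  regroup = solve-∀

departures-suc : ∀ u K m n →
  departures u K (suc m) (suc n) ≡ departures u K m n ⊓ (departures u K (suc m) n + u (suc n) (K ∸ suc m))
departures-suc u K m n =
  trans (+-distribˡ-⊓ C (L + S) (u (suc n) (K ∸ suc m))) (cong (_⊓ (C + u (suc n) (K ∸ suc m))) (departures-inflow u K m n))
  where
  C = departures u K (suc m) n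
  L = proj₁ (store u K (suc m) n)
  S = proj₂ (store u K m n)

m∸n≡suc[m∸suc[n]] : ∀ {m n} → n < m → m ∸ n ≡ suc (m ∸ suc n)
m∸n≡suc[m∸suc[n]] {suc m} {zero}  _         = refl
m∸n≡suc[m∸suc[n]] {suc m} {suc n} (s≤s n<m) = m∸n≡suc[m∸suc[n]] n<m

minSelection≡departures : ∀ u K n m → m < K → minSelection 1 K (rsk (word u K n)) (K ∸ m) ≡ just (departures u K m n)
minSelection≡departures u K zero    m _   = minSelection-[] 1 K (K ∸ m) (m∸n≤m K m)
minSelection≡departures u K (suc n) m m<K = begin
  minSelection 1 K (rsk (word u K (suc n))) (K ∸ m)
    ≡⟨ cong₂ (minSelection 1 K) (rsk-word-suc u K n) (m∸n≡suc[m∸suc[n]] m<K) ⟩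
  minSelection 1 K (insertAll w T) (suc a)
    ≡⟨ minSelection-insertAll 1 K w T (rsk-word-Staircase u K n K) (block-sorted u (suc n) K) (block-≥1 u (suc n) K) a ⟩
  S (suc (suc a)) ⊓∞ S (suc a) +∞ countOf (suc a) w
    ≡⟨ cong₂ (λ s c → S (suc (suc a)) ⊓∞ s +∞ c)
             (trans (cong S (sym a≡)) (minSelection≡departures u K n m m<K))
             (trans (cong (λ k → countOf k w) (sym a≡)) (block-countOf u (suc n) K (K ∸ m) (subst (1 ≤_) (sym a≡) (s≤s z≤n)) (m∸n≤m K m))) ⟩
  S (suc (suc a)) ⊓∞ just (departures u K m n + u (suc n) (K ∸ m))
    ≡⟨ step m m<K ⟩
  just (departures u K m (suc n)) ∎
  where
  open ≡-Reasoning
  T = rsk (word u K n)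
  w = block u (suc n) K
  S = minSelection 1 K T
  a = K ∸ suc m
  a≡ : K ∸ m ≡ suc a
  a≡ = m∸n≡suc[m∸suc[n]] m<K
  step : ∀ m → m < K → S (suc (suc (K ∸ suc m))) ⊓∞ just (departures u K m n + u (suc n) (K ∸ m)) ≡ just (departures u K m (suc n))
  step zero    0<K rewrite sym (m∸n≡suc[m∸suc[n]] 0<K) | minSelection-∞ 1 K T (suc K) (n<1+n K) = refl
  step (suc m) m<K
    rewrite sym (m∸n≡suc[m∸suc[n]] m<K) | sym (m∸n≡suc[m∸suc[n]] (<-trans (n<1+n m) m<K))
          | minSelection≡departures u K n m (<-trans (n<1+n m) m<K) = cong just (sym (departures-suc u K m n))

lastPart≡departures : ∀ u K N → shapePart (rsk (word u (suc K) N)) (suc K) ≡ departures u (suc K) K N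
lastPart≡departures u K N = just-injective (begin
  just (shapePart T (suc K))           ≡⟨ cong just (shapePart≡length-row T K) ⟩
  just (length (row T K))              ≡⟨ cong just (length≡countOf (row T K) (Staircase-row 1 (suc K) T K (n<1+n K) (rsk-word-Staircase u (suc K) N (suc K)))
                                                                   (All-row T (rsk-word-≤ u (suc K) N) K)) ⟩
  just (countOf (suc K) (row T K))     ≡⟨ sym (minSelection-one 1 K T (rsk-word-DiagonalDecreasing u (suc K) N (suc K))) ⟩
  minSelection 1 (suc K) T 1           ≡⟨ cong (minSelection 1 (suc K) T) (sym (m+n∸n≡m 1 K)) ⟩
  minSelection 1 (suc K) T (suc K ∸ K) ≡⟨ minSelection≡departures u (suc K) N K (n<1+n K) ⟩
  just (departures u (suc K) K N)      ∎)
  where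
  open ≡-Reasoning
  T = rsk (word u (suc K) N)

departures≡sum : ∀ u K m n → departures u K m n ≡ sum (map (λ t → proj₂ (store u K m t)) (from1 n))
departures≡sum u K m zero    = refl
departures≡sum u K m (suc n) = begin
  departures u K m n + R (suc n)                 ≡⟨ cong (_+ R (suc n)) (departures≡sum u K m n) ⟩
  sum (map R (from1 n)) + R (suc n)              ≡⟨ cong (sum (map R (from1 n)) +_) (sym (+-identityʳ (R (suc n)))) ⟩
  sum (map R (from1 n)) + sum (R (suc n) ∷ [])   ≡⟨ sym (sum-++ (map R (from1 n)) (R (suc n) ∷ [])) ⟩
  sum (map R (from1 n) ++ R (suc n) ∷ [])        ≡⟨ cong sum (sym (map-++ R (from1 n) (suc n ∷ []))) ⟩
  sum (map R (from1 (suc n)))                    ∎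
  where
  open ≡-Reasoning
  R : ℕ → ℕ
  R t = proj₂ (store u K m t)

-- Lattice paths

last-∷ʳ : ∀ {A : Set} (xs : List A) p → last (xs ∷ʳ p) ≡ just p
last-∷ʳ []           p = refl
last-∷ʳ (_ ∷ [])     p = refl
last-∷ʳ (_ ∷ z ∷ zs) p = last-∷ʳ (z ∷ zs) p

Chain-∷ʳ⁻ : ∀ {S} y ys p → Chain S ((y ∷ ys) ∷ʳ p) → Chain S (y ∷ ys) × ∃ λ q → last (y ∷ ys) ≡ just q × S q p
Chain-∷ʳ⁻ y []       p (s ∷ [-]) = [-] , y , refl , s
Chain-∷ʳ⁻ y (z ∷ zs) p (s ∷ c)   = let (c' , q , e , s') = Chain-∷ʳ⁻ z zs p c in s ∷ c' , q , e , s'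

Chain-∷ʳ⁺ : ∀ {S} y ys {p q} → Chain S (y ∷ ys) → last (y ∷ ys) ≡ just q → S q p → Chain S ((y ∷ ys) ∷ʳ p)
Chain-∷ʳ⁺ y []       [-]      refl s = s ∷ [-]
Chain-∷ʳ⁺ y (z ∷ zs) (s₀ ∷ c) e    s = s₀ ∷ Chain-∷ʳ⁺ z zs c e s

weight-∷ʳ : ∀ u xs (p : Point) → weight u (xs ∷ʳ p) ≡ weight u xs + u (proj₁ p) (proj₂ p)
weight-∷ʳ u xs p = begin
  sum (map f (xs ∷ʳ p))         ≡⟨ cong sum (map-++ f xs (p ∷ [])) ⟩
  sum (map f xs ++ f p ∷ [])    ≡⟨ sum-++ (map f xs) (f p ∷ []) ⟩
  sum (map f xs) + (f p + 0)    ≡⟨ cong (sum (map f xs) +_) (+-identityʳ (f p)) ⟩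
  sum (map f xs) + f p          ∎
  where
  open ≡-Reasoning
  f : Point → ℕ
  f q = u (proj₁ q) (proj₂ q)

just-,-injective : ∀ {A B : Set} {a c : A} {b d : B} → just (a , b) ≡ just (c , d) → a ≡ c × b ≡ d
just-,-injective e = ,-injective (just-injective e)

UpRight-mono : ∀ {π} → Chain UpRight π → ∀ {a b c d} → head π ≡ just (a , b) → last π ≡ just (c , d) → a ≤ c × b ≤ d
UpRight-mono [-]                eh el with refl ← trans (sym eh) el = ≤-refl , ≤-refl
UpRight-mono (_∷_ {q = _ , _} s c) refl el with UpRight-mono c refl el | s
... | a'≤c , b'≤d | inj₁ (refl , refl) = ≤-trans (n≤1+n _) a'≤c , b'≤d
... | a'≤c , b'≤d | inj₂ (refl , refl) = a'≤c , ≤-trans (n≤1+n _) b'≤d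

weight-∷ʳ-≤ : ∀ u xs a b {D} → weight u xs ≤ D → weight u (xs ∷ʳ (a , b)) ≤ D + u a b
weight-∷ʳ-≤ u xs a b w≤D = ≤-trans (≤-reflexive (weight-∷ʳ u xs (a , b))) (+-monoˡ-≤ (u a b) w≤D)

Π-weight≤Dq : ∀ u n j π → InΠ (suc n) (suc j) π → weight u π ≤ Dq u (suc n) (suc j)
Π-weight≤Dq u n j π (eh , el , c) with initLast π
Π-weight≤Dq u n j .[] (() , _ , _) | []
... | xs ∷ʳ′ p with refl ← just-injective (trans (sym (last-∷ʳ xs p)) el) with xs
... | [] with refl ← eh = ≤-reflexive (+-identityʳ _)
... | y ∷ ys with Chain-∷ʳ⁻ y ys _ c
... | c' , (zero , _) , el' , inj₁ (refl , refl) = contradiction (proj₁ (UpRight-mono c' eh el')) λ ()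
... | c' , (_ , zero) , el' , inj₂ (refl , refl) = contradiction (proj₂ (UpRight-mono c' eh el')) λ ()
... | c' , (suc n' , _) , el' , inj₁ (refl , refl) =
  weight-∷ʳ-≤ u (y ∷ ys) _ _ (≤-trans (Π-weight≤Dq u n' j (y ∷ ys) (eh , el' , c')) (m≤m⊔n (Dq u n (suc j)) (Dq u (suc n) j)))
... | c' , (_ , suc j') , el' , inj₂ (refl , refl) =
  weight-∷ʳ-≤ u (y ∷ ys) _ _ (≤-trans (Π-weight≤Dq u n j' (y ∷ ys) (eh , el' , c')) (m≤n⊔m (Dq u n (suc j)) (Dq u (suc n) j)))

Π-extend : ∀ u {a b c d D D'} → UpRight (a , b) (c , d) → (∃ λ π → InΠ a b π × weight u π ≡ D) → D ≡ D' →
  ∃ λ π → InΠ c d π × weight u π ≡ D' + u c d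
Π-extend u step ([] , (() , _) , _) _
Π-extend u {c = c} {d} step (y ∷ ys , (eh , el , ch) , w) D≡D' =
  (y ∷ ys) ∷ʳ (c , d) ,
  (eh , last-∷ʳ (y ∷ ys) (c , d) , Chain-∷ʳ⁺ y ys ch el step) ,
  trans (weight-∷ʳ u (y ∷ ys) (c , d)) (cong (_+ u c d) (trans w D≡D'))

Π-attains-Dq : ∀ u n j → ∃ λ π → InΠ (suc n) (suc j) π × weight u π ≡ Dq u (suc n) (suc j)
Π-attains-Dq u zero    zero    = (1 , 1) ∷ [] , (refl , refl , [-]) , +-identityʳ _
Π-attains-Dq u zero    (suc j) = Π-extend u (inj₂ (refl , refl)) (Π-attains-Dq u zero j) refl
Π-attains-Dq u (suc n) zero    = Π-extend u (inj₁ (refl , refl)) (Π-attains-Dq u n zero) (sym (⊔-identityʳ _))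
Π-attains-Dq u (suc n) (suc j) with ≤-total (Dq u (suc n) (suc (suc j))) (Dq u (suc (suc n)) (suc j))
... | inj₁ le = Π-extend u (inj₂ (refl , refl)) (Π-attains-Dq u (suc n) j) (sym (m≤n⇒m⊔n≡n le))
... | inj₂ ge = Π-extend u (inj₁ (refl , refl)) (Π-attains-Dq u n (suc j)) (sym (m≥n⇒m⊔n≡m ge))

Diag-mono : ∀ {π} → Chain Diag π → ∀ {a b c d} → head π ≡ just (a , b) → last π ≡ just (c , d) →
  a ≤ c × d ≤ b × a + b ≤ c + d
Diag-mono [-] eh el with refl ← trans (sym eh) el = ≤-refl , ≤-refl , ≤-refl
Diag-mono (_∷_ {q = q₁ , q₂} (t , refl , refl) c) {a} refl el with Diag-mono c refl el
... | q₁≤c , d≤q₂ , q≤cd =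
  ≤-trans (m≤m+n a (suc t)) q₁≤c ,
  ≤-trans d≤q₂ (m≤m+n q₂ t) ,
  ≤-trans (≤-reflexive (x∙yz≈xz∙y a q₂ t)) (≤-trans (+-monoˡ-≤ q₂ (+-monoʳ-≤ a (n≤1+n t))) q≤cd)

-- The paths of Π̃ relevant to store m+1 after n slots; Π̃ itself is the case m = K − 1, n = N.
DiagPath : ℕ → ℕ → ℕ → List Point → Set
DiagPath K m n π =
  (∃ λ i → i ≤ m × head π ≡ just (suc i , K ∸ i)) ×
  (∃ λ t → t < n × last π ≡ just (n ∸ t , K ∸ m + t)) ×
  Chain Diag π

K∸suc[m]+suc[t] : ∀ K m t → m < K → K ∸ suc m + suc t ≡ K ∸ m + t
K∸suc[m]+suc[t] K m t m<K = trans (+-suc (K ∸ suc m) t) (cong (_+ t) (sym (m∸n≡suc[m∸suc[n]] m<K)))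

DiagPath-m<n : ∀ K m n π → m < K → DiagPath K m n π → m < n
DiagPath-m<n K m n π m<K ((i , i≤m , eh) , (t , t<n , el) , c) = +-cancelʳ-≤ (K ∸ m) (suc m) n (begin
  suc m + (K ∸ m)          ≡⟨ cong suc (m+[n∸m]≡n (<⇒≤ m<K)) ⟩
  suc K                    ≡⟨ cong suc (sym (m+[n∸m]≡n (≤-trans i≤m (<⇒≤ m<K)))) ⟩
  suc i + (K ∸ i)          ≤⟨ proj₂ (proj₂ (Diag-mono c eh el)) ⟩
  n ∸ t + (K ∸ m + t)      ≡⟨ x∙yz≈xz∙y (n ∸ t) (K ∸ m) t ⟩
  n ∸ t + t + (K ∸ m)      ≡⟨ cong (_+ (K ∸ m)) (m∸n+n≡m (<⇒≤ t<n)) ⟩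
  n + (K ∸ m)              ∎)
  where open ≤-Reasoning

departures-≡0 : ∀ u K m n → n ≤ m → departures u K m n ≡ 0
departures-≡0 u K m       zero    _         = refl
departures-≡0 u K (suc m) (suc n) (s≤s n≤m) rewrite departures-suc u K m n | departures-≡0 u K m n n≤m = refl

departures-≤-upstream : ∀ u K m n → departures u K (suc m) (suc n) ≤ departures u K m n
departures-≤-upstream u K m n rewrite departures-suc u K m n = m⊓n≤m _ _

departures-suc-≤ : ∀ u K m n → departures u K m (suc n) ≤ departures u K m n + u (suc n) (K ∸ m)
departures-suc-≤ u K zero    n = ≤-refl
departures-suc-≤ u K (suc m) n rewrite departures-suc u K m n = m⊓n≤n _ _

departures≤weight : ∀ u K n m → m < K → ∀ π → DiagPath K m n π → departures u K m n ≤ weight u π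
departures≤weight u K zero    m       _   π (_ , (_ , () , _) , _)
departures≤weight u K (suc n) zero    _   π ((zero , _ , eh) , (suc t , _ , el) , c) =
  contradiction (proj₁ (proj₂ (Diag-mono c eh el))) (m+1+n≰m K)
departures≤weight u K (suc n) (suc m) m<K π ((i , i≤ , eh) , (suc t , s≤s t<n , el) , c) with m≤n⇒m<n∨m≡n i≤
... | inj₂ refl      = contradiction (proj₁ (proj₂ (Diag-mono c eh el))) (m+1+n≰m (K ∸ suc m))
... | inj₁ (s≤s i≤m) = ≤-trans (departures-≤-upstream u K m n) (departures≤weight u K n m (<-trans (n<1+n m) m<K) π
    ((i , i≤m , eh) , (t , t<n , trans el (cong (λ d → just (n ∸ t , d)) (K∸suc[m]+suc[t] K m t (<-trans (n<1+n m) m<K)))) , c))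
departures≤weight u K (suc n) m m<K π ((i , i≤m , eh) , (zero , _ , el) , c) with initLast π
departures≤weight u K (suc n) m m<K .[] ((_ , _ , ()) , _) | []
... | xs ∷ʳ′ p with refl ← just-injective (trans (sym (last-∷ʳ xs p)) (trans el (cong (λ d → just (suc n , d)) (+-identityʳ (K ∸ m))))) with xs
... | [] with refl , K∸m≡K∸i ← just-,-injective eh = begin
  departures u K m (suc n)               ≤⟨ departures-suc-≤ u K m n ⟩
  departures u K m n + u (suc n) (K ∸ m) ≡⟨ cong (_+ u (suc n) (K ∸ m)) (departures-≡0 u K m n (≤-reflexive n≡m)) ⟩
  u (suc n) (K ∸ m)                      ≡⟨ sym (+-identityʳ _) ⟩
  weight u ((suc n , K ∸ m) ∷ [])        ∎
  where
  open ≤-Reasoning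
  n≡m : n ≡ m
  n≡m = ∸-cancelˡ-≡ (≤-trans i≤m (<⇒≤ m<K)) (<⇒≤ m<K) (sym K∸m≡K∸i)
... | y ∷ ys with Chain-∷ʳ⁻ y ys _ c
... | c' , (qa , _) , el' , (s , 1+n≡qa+1+s , refl) = begin
  departures u K m (suc n)                    ≤⟨ departures-suc-≤ u K m n ⟩
  departures u K m n + u (suc n) (K ∸ m)      ≤⟨ +-monoˡ-≤ _ (departures≤weight u K n m m<K (y ∷ ys) ((i , i≤m , eh) , (s , s<n , el'') , c')) ⟩
  weight u (y ∷ ys) + u (suc n) (K ∸ m)       ≡⟨ sym (weight-∷ʳ u (y ∷ ys) _) ⟩
  weight u ((y ∷ ys) ∷ʳ (suc n , K ∸ m))      ∎
  where
  open ≤-Reasoning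
  n≡qa+s : n ≡ qa + s
  n≡qa+s = suc-injective (trans 1+n≡qa+1+s (+-suc qa s))
  s<n : s < n
  s<n = ≤-trans (+-monoˡ-≤ s (≤-trans (s≤s z≤n) (proj₁ (Diag-mono c' eh el')))) (≤-reflexive (sym n≡qa+s))
  el'' : last (y ∷ ys) ≡ just (n ∸ s , K ∸ m + s)
  el'' = trans el' (cong (λ a → just (a , K ∸ m + s)) (trans (sym (m+n∸n≡m qa s)) (cong (_∸ s) (sym n≡qa+s))))

DiagPath-∷ʳ : ∀ K m n π → DiagPath K m n π → DiagPath K m (suc n) (π ∷ʳ (suc n , K ∸ m))
DiagPath-∷ʳ K m n []       ((_ , _ , ()) , _)
DiagPath-∷ʳ K m n (y ∷ ys) ((i , i≤m , eh) , (s , s<n , el) , c) =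
  (i , i≤m , eh) ,
  (0 , s≤s z≤n , trans (last-∷ʳ (y ∷ ys) _) (cong (λ d → just (suc n , d)) (sym (+-identityʳ (K ∸ m))))) ,
  Chain-∷ʳ⁺ y ys c el (s , trans (cong suc (sym (m∸n+n≡m (<⇒≤ s<n)))) (sym (+-suc (n ∸ s) s)) , refl)

DiagPath-shift : ∀ K m n π → suc m < K → DiagPath K m n π → DiagPath K (suc m) (suc n) π
DiagPath-shift K m n π m<K ((i , i≤m , eh) , (t , t<n , el) , c) =
  (i , m≤n⇒m≤1+n i≤m , eh) ,
  (suc t , s≤s t<n , trans el (cong (λ d → just (n ∸ t , d)) (sym (K∸suc[m]+suc[t] K m t (<-trans (n<1+n m) m<K))))) ,
  c

departures-attained : ∀ u K n m → m < K → m < n → ∃ λ π → DiagPath K m n π × weight u π ≡ departures u K m n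
departures-attained-ending : ∀ u K n m → m < K → m ≤ n →
  ∃ λ π → DiagPath K m (suc n) π × weight u π ≡ departures u K m n + u (suc n) (K ∸ m)

departures-attained u K zero    m       _   ()
departures-attained u K (suc n) zero    0<K _ = departures-attained-ending u K n zero 0<K z≤n
departures-attained u K (suc n) (suc m) m<K (s≤s m<n)
  with ≤-total (departures u K m n) (departures u K (suc m) n + u (suc n) (K ∸ suc m))
... | inj₁ le = let (π , p , w) = departures-attained u K n m (<-trans (n<1+n m) m<K) m<n in
  π , DiagPath-shift K m n π m<K p , trans w (trans (sym (m≤n⇒m⊓n≡m le)) (sym (departures-suc u K m n)))
... | inj₂ ge = let (π , p , w) = departures-attained-ending u K n (suc m) m<K m<n in
  π , p , trans w (trans (sym (m≥n⇒m⊓n≡n ge)) (sym (departures-suc u K m n)))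

departures-attained-ending u K n m m<K m≤n with m≤n⇒m<n∨m≡n m≤n
... | inj₁ m<n = let (π , p , w) = departures-attained u K n m m<K m<n in
  π ∷ʳ _ , DiagPath-∷ʳ K m n π p , trans (weight-∷ʳ u π _) (cong (_+ u (suc n) (K ∸ m)) w)
... | inj₂ refl =
  (suc m , K ∸ m) ∷ [] ,
  ((m , ≤-refl , refl) , (0 , s≤s z≤n , cong (λ d → just (suc m , d)) (sym (+-identityʳ (K ∸ m)))) , [-]) ,
  trans (+-identityʳ _) (cong (_+ u (suc m) (K ∸ m)) (sym (departures-≡0 u K m m ≤-refl)))

Π-isMax : ∀ u N K → IsMax (InΠ (suc N) (suc K)) (weight u) (Dq u (suc N) (suc K))
Π-isMax u N K = Π-attains-Dq u N K , Π-weight≤Dq u N K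

InΠ~⇒DiagPath : ∀ N K π → InΠ~ N (suc K) π → DiagPath (suc K) K N π
InΠ~⇒DiagPath N K π ((i , i<1+K , eh) , (j , j<N , el) , c) =
  (i , s≤s⁻¹ i<1+K , eh) , (j , j<N , trans el (cong (λ d → just (N ∸ j , d + j)) (sym (m+n∸n≡m 1 K)))) , c

DiagPath⇒InΠ~ : ∀ N K π → DiagPath (suc K) K N π → InΠ~ N (suc K) π
DiagPath⇒InΠ~ N K π ((i , i≤K , eh) , (t , t<N , el) , c) =
  (i , s≤s i≤K , eh) , (t , t<N , trans el (cong (λ d → just (N ∸ t , d + t)) (m+n∸n≡m 1 K))) , c

Π~-isMin : ∀ u N K → IsMin0 (InΠ~ N (suc K)) (weight u) (departures u (suc K) K N)
Π~-isMin u N K with K <? N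
... | yes K<N = let (π , p , w) = departures-attained u (suc K) N K (n<1+n K) K<N in
  inj₁ ((π , DiagPath⇒InΠ~ N K π p , w) ,
        λ π' p' → departures≤weight u (suc K) N K (n<1+n K) π' (InΠ~⇒DiagPath N K π' p'))
... | no  K≮N =
  inj₂ ((λ (π , p) → <⇒≱ (DiagPath-m<n (suc K) K N π (n<1+n K) (InΠ~⇒DiagPath N K π p)) (≮⇒≥ K≮N)) ,
        departures-≡0 u (suc K) K N (≮⇒≥ K≮N))

theorem3 : (K N : ℕ) → 1 ≤ K → 1 ≤ N → (u : Array) →
    IsMax (InΠ N K) (weight u) (shapePart (rsk (word u K N)) 1) ×
    shapePart (rsk (word u K N)) 1 ≡ Dq u N K ×
    IsMin0 (InΠ~ N K) (weight u) (shapePart (rsk (word u K N)) K) ×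
    shapePart (rsk (word u K N)) K ≡ Rtot u K N
theorem3 (suc K) (suc N) _ _ u =
  subst (IsMax (InΠ (suc N) (suc K)) (weight u)) (sym (firstPart≡Dq u (suc K) (suc N))) (Π-isMax u N K) ,
  firstPart≡Dq u (suc K) (suc N) ,
  subst (IsMin0 (InΠ~ (suc N) (suc K)) (weight u)) (sym (lastPart≡departures u K (suc N))) (Π~-isMin u (suc N) K) ,
  trans (lastPart≡departures u K (suc N)) (departures≡sum u (suc K) K (suc N))
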